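{- Let $t\ge1$ and $\beta>0$, and let $G$ be a connected $(U,W,\beta)$-bipartite graph with $|W|\ge t|U|$. Then $$\alpha'(G)\ge\min\left\{t/\beta^2,\,1\right\}\cdot|U|.$$
   Context: All graphs are finite, simple and nonempty. $\alpha'(G)$ is the matching number. For vertex sets $X,Y$, $e(X,Y)$ is the number of edges between $X$ and $Y$. A bipartite graph $G$ with bipartition $(U,W)$ is a $(U,W,\beta)$-bipartite graph if $\frac{|X||Y|}{(|U|-|X|)(|W|-|Y|)}\le\beta^2$ for every pair of subsets $X\subseteq U$, $Y\subseteq W$ with $e(X,Y)=0$.
   Formalization: The parameters t and β take rational values. -}

module Defs where

open import Data.Nat as ℕ using (ℕ; _∸_)
open import Data.Integer using (+_)
open import Data.Rational using (ℚ; _/_; _*_; _≤_; Positive; NonZero)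
open import Data.Rational.Properties using (pos*pos⇒pos; pos⇒nonZero)
open import Data.Bool using (Bool; true; false)
open import Data.Fin using (Fin)
open import Data.Fin.Subset using (Subset; _∈_; ∣_∣)
open import Data.Sum using (_⊎_; inj₁; inj₂)
open import Data.Product using (Σ; ∃; _×_)
open import Function.Definitions using (Injective)
open import Relation.Binary.PropositionalEquality using (_≡_)
open import Relation.Binary.Construct.Closure.ReflexiveTransitive using (Star)

ℕ→ℚ : ℕ → ℚ
ℕ→ℚ n = + n / 1

-- A finite simple bipartite graph with parts U = Fin m and W = Fin n;
-- adj i j = true iff {u_i, w_j} is an edge.
BipGraph : ℕ → ℕ → Set
BipGraph m n = Fin m → Fin n → Bool

Vertex : ℕ → ℕ → Set
Vertex m n = Fin m ⊎ Fin n

data Adj {m n : ℕ} (G : BipGraph m n) : Vertex m n → Vertex m n → Set where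
  uw : ∀ {i j} → G i j ≡ true → Adj G (inj₁ i) (inj₂ j)
  wu : ∀ {i j} → G i j ≡ true → Adj G (inj₂ j) (inj₁ i)

Connected : {m n : ℕ} → BipGraph m n → Set
Connected {m} {n} G = (x y : Vertex m n) → Star (Adj G) x y

NoEdges : {m n : ℕ} → BipGraph m n → Subset m → Subset n → Set
NoEdges {m} {n} G X Y = (i : Fin m) (j : Fin n) → i ∈ X → j ∈ Y → G i j ≡ false

-- (U,W,β)-bipartite, with the ratio condition cross-multiplied:
-- |X||Y| ≤ β² (|U|-|X|)(|W|-|Y|) whenever e(X,Y) = 0.
IsBetaBipartite : {m n : ℕ} → BipGraph m n → ℚ → Set
IsBetaBipartite {m} {n} G β =
  (X : Subset m) (Y : Subset n) → NoEdges G X Y →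
  ℕ→ℚ ∣ X ∣ * ℕ→ℚ ∣ Y ∣ ≤ (β * β) * (ℕ→ℚ (m ∸ ∣ X ∣) * ℕ→ℚ (n ∸ ∣ Y ∣))

Matching : {m n : ℕ} → BipGraph m n → ℕ → Set
Matching {m} {n} G k =
  Σ (Fin k → Fin m) λ f → Σ (Fin k → Fin n) λ g →
    Injective _≡_ _≡_ f × Injective _≡_ _≡_ g × ((a : Fin k) → G (f a) (g a) ≡ true)

MatchingNumberAtLeast : {m n : ℕ} → BipGraph m n → ℚ → Set
MatchingNumberAtLeast G c = ∃ λ k → Matching G k × c ≤ ℕ→ℚ k

sq-nonZero : (β : ℚ) → .{{Positive β}} → NonZero (β * β)
sq-nonZero β = pos⇒nonZero (β * β) {{pos*pos⇒pos β β}}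

{-# OPTIONS --safe #-}
-- Ore's deficiency form of Hall's theorem gives a matching of size k and a set X ⊆ U with
-- m - k ≤ |X| - |Γ(X)|.  If |X| ≤ |Γ(X)| then k ≥ m.  Otherwise there are no edges between X and
-- Y = W ∖ Γ(X), so the β-condition reads |X| (n - |Γ(X)|) ≤ β² (m - |X|) |Γ(X)|; together with
-- n ≥ t m ≥ m and k ≥ (m - |X|) + |Γ(X)| this forces t m ≤ β² k.
--
-- Hall's theorem with deficiency d is proved by deleting edges.  If some u ∈ U has two neighbours
-- w₁ ≠ w₂, the submodularity of |Γ| shows that the condition survives the deletion of uw₁ or of
-- uw₂; once every vertex of U has at most one neighbour, the edges form a matching that covers
-- Γ(U), and |Γ(U)| ≥ m - d.
module Submission where

module Matchings where

  open import Algebra.Properties.CommutativeSemigroup using (interchange)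
  open import Data.Fin using (Fin; zero; suc; _≟_)
  open import Data.Fin.Properties using (any?; suc-injective)
  open import Data.Fin.Subset
  open import Data.Fin.Subset.Properties
  open import Data.Nat using (ℕ; zero; suc; _+_; _≤_; _<_; z≤n; s≤s; _≤?_; _<?_)
  open import Data.Nat.Induction using (<-wellFounded)
  open import Data.Nat.Properties
    using (≤-reflexive; ≤-trans; ≤-pred; ≤-<-trans; <⇒≱; ≰⇒>; ≮⇒≥; +-suc; +-comm; +-assoc;
           +-identityʳ; n≤1+n; +-mono-≤; +-monoˡ-≤; +-monoʳ-≤; +-monoˡ-<; +-monoʳ-<; m≤m+n; m≤n+m;
           +-0-monoid; +-commutativeSemigroup; module ≤-Reasoning)
  open import Algebra.Properties.Monoid.Sum +-0-monoid using (sum)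
  open import Data.Product using (∃-syntax; ∃₂; _×_; _,_)
  open import Data.Sum using (_⊎_; inj₁; inj₂; [_,_]′)
  open import Data.Vec using ([]; _∷_; here; there)
  open import Data.Vec.Functional using (Vector; head; tail; updateAt)
  open import Data.Vec.Functional.Properties using (updateAt-updates; updateAt-minimal)
  open import Function using (_∘_; id)
  open import Function.Definitions using (Injective)
  open import Induction.WellFounded using (Acc; acc)
  open import Relation.Binary.PropositionalEquality using (_≡_; _≢_; refl; sym; trans; cong; subst)
  open import Relation.Nullary using (yes; no; ¬?; _×-dec_)
  open import Relation.Nullary.Decidable using (decidable-stable)
  open import Relation.Nullary.Negation using (contradiction)

  variable
    m n k d : ℕ

  ∣p∪q∣+∣p∩q∣≡∣p∣+∣q∣ : (p q : Subset n) → ∣ p ∪ q ∣ + ∣ p ∩ q ∣ ≡ ∣ p ∣ + ∣ q ∣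
  ∣p∪q∣+∣p∩q∣≡∣p∣+∣q∣ []            []            = refl
  ∣p∪q∣+∣p∩q∣≡∣p∣+∣q∣ (inside  ∷ p) (inside  ∷ q) =
    cong suc (trans (+-suc _ _) (trans (cong suc (∣p∪q∣+∣p∩q∣≡∣p∣+∣q∣ p q)) (sym (+-suc _ _))))
  ∣p∪q∣+∣p∩q∣≡∣p∣+∣q∣ (inside  ∷ p) (outside ∷ q) = cong suc (∣p∪q∣+∣p∩q∣≡∣p∣+∣q∣ p q)
  ∣p∪q∣+∣p∩q∣≡∣p∣+∣q∣ (outside ∷ p) (inside  ∷ q) =
    trans (cong suc (∣p∪q∣+∣p∩q∣≡∣p∣+∣q∣ p q)) (sym (+-suc _ _))
  ∣p∪q∣+∣p∩q∣≡∣p∣+∣q∣ (outside ∷ p) (outside ∷ q) = ∣p∪q∣+∣p∩q∣≡∣p∣+∣q∣ p q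

  ∣p∪q∣≤∣p∣+∣q∣ : (p q : Subset n) → ∣ p ∪ q ∣ ≤ ∣ p ∣ + ∣ q ∣
  ∣p∪q∣≤∣p∣+∣q∣ p q = ≤-trans (m≤m+n _ _) (≤-reflexive (∣p∪q∣+∣p∩q∣≡∣p∣+∣q∣ p q))

  ∣p∣≤1+∣p-x∣ : (p : Subset n) (x : Fin n) → ∣ p ∣ ≤ suc ∣ p - x ∣
  ∣p∣≤1+∣p-x∣ (inside  ∷ p) zero    = ≤-reflexive (cong (suc ∘ ∣_∣) (sym (p─⊥≡p p)))
  ∣p∣≤1+∣p-x∣ (outside ∷ p) zero    = subst (λ q → ∣ p ∣ ≤ suc ∣ q ∣) (sym (p─⊥≡p p)) (n≤1+n _)
  ∣p∣≤1+∣p-x∣ (inside  ∷ p) (suc x) = s≤s (∣p∣≤1+∣p-x∣ p x)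
  ∣p∣≤1+∣p-x∣ (outside ∷ p) (suc x) = ∣p∣≤1+∣p-x∣ p x

  x∈p─q⇒x∉q : (p q : Subset n) {x : Fin n} → x ∈ p ─ q → x ∉ q
  x∈p─q⇒x∉q (_ ∷ p) (inside ∷ q) () here
  x∈p─q⇒x∉q (_ ∷ p) (_      ∷ q) (there x∈p─q) (there x∈q) = x∈p─q⇒x∉q p q x∈p─q x∈q

  1≤∣p∣⇒Nonempty : {p : Subset n} → 1 ≤ ∣ p ∣ → Nonempty p
  1≤∣p∣⇒Nonempty {p = inside  ∷ p} _ = zero , here
  1≤∣p∣⇒Nonempty {p = outside ∷ p} 1≤∣p∣ =
    let (x , x∈p) = 1≤∣p∣⇒Nonempty 1≤∣p∣ in suc x , there x∈p

  2≤∣p∣⇒∃≢ : {p : Subset n} → 2 ≤ ∣ p ∣ → ∃₂ λ x y → x ∈ p × y ∈ p × x ≢ y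
  2≤∣p∣⇒∃≢ {p = inside  ∷ p} (s≤s 1≤∣p∣) =
    let (y , y∈p) = 1≤∣p∣⇒Nonempty 1≤∣p∣ in zero , suc y , here , there y∈p , λ ()
  2≤∣p∣⇒∃≢ {p = outside ∷ p} 2≤∣p∣ =
    let (x , y , x∈p , y∈p , x≢y) = 2≤∣p∣⇒∃≢ 2≤∣p∣ in
    suc x , suc y , there x∈p , there y∈p , x≢y ∘ suc-injective

  Biadjacency : ℕ → ℕ → Set
  Biadjacency m n = Vector (Subset n) m

  Γ : Biadjacency m n → Subset m → Subset n
  Γ H []            = ⊥
  Γ H (inside  ∷ X) = head H ∪ Γ (tail H) X
  Γ H (outside ∷ X) = Γ (tail H) X

  Γ-⊥ : (H : Biadjacency m n) → Γ H ⊥ ≡ ⊥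
  Γ-⊥ {zero}  H = refl
  Γ-⊥ {suc m} H = Γ-⊥ (tail H)

  ∈Γ⁺ : (H : Biadjacency m n) (X : Subset m) {i : Fin m} → i ∈ X → H i ⊆ Γ H X
  ∈Γ⁺ H (inside  ∷ X) here        j∈Hi = x∈p∪q⁺ (inj₁ j∈Hi)
  ∈Γ⁺ H (inside  ∷ X) (there i∈X) j∈Hi = x∈p∪q⁺ (inj₂ (∈Γ⁺ (tail H) X i∈X j∈Hi))
  ∈Γ⁺ H (outside ∷ X) (there i∈X) j∈Hi = ∈Γ⁺ (tail H) X i∈X j∈Hi

  Γ-least : (H : Biadjacency m n) (X : Subset m) {S : Subset n} →
            (∀ {i} → i ∈ X → H i ⊆ S) → Γ H X ⊆ S
  Γ-least H []            rows⊆S j∈⊥ = contradiction j∈⊥ ∉⊥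
  Γ-least H (inside  ∷ X) rows⊆S j∈Γ =
    [ rows⊆S here , Γ-least (tail H) X (rows⊆S ∘ there) ]′ (x∈p∪q⁻ (head H) _ j∈Γ)
  Γ-least H (outside ∷ X) rows⊆S = Γ-least (tail H) X (rows⊆S ∘ there)

  record Matching (H : Biadjacency m n) (k : ℕ) : Set where
    field
      left            : Fin k → Fin m
      right           : Fin k → Fin n
      left-injective  : Injective _≡_ _≡_ left
      right-injective : Injective _≡_ _≡_ right
      edge            : ∀ a → right a ∈ H (left a)

  open Matching

  emptyMatching : {H : Biadjacency m n} → Matching H 0
  emptyMatching = record
    { left = λ () ; right = λ () ; left-injective = λ {} ; right-injective = λ {} ; edge = λ () }

  Matching-mono : {H H′ : Biadjacency m n} → (∀ i → H i ⊆ H′ i) → Matching H k → Matching H′ k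
  Matching-mono H⊆H′ M = record
    { left = left M ; right = right M
    ; left-injective = left-injective M ; right-injective = right-injective M
    ; edge = λ a → H⊆H′ (left M a) (edge M a) }

  Matching-tail : {H : Biadjacency (suc m) n} → Matching (tail H) k → Matching H k
  Matching-tail M = record
    { left = suc ∘ left M ; right = right M
    ; left-injective = left-injective M ∘ suc-injective ; right-injective = right-injective M
    ; edge = edge M }

  extendMatching : ∀ {m n k} {H : Biadjacency (suc m) n} {w : Fin n} (M : Matching (tail H) k) →
                   w ∈ head H → (∀ a → right M a ≢ w) → Matching H (suc k)
  extendMatching {m} {n} {k} {H} {w} M w∈H₀ w-unmatched = record
    { left = left′ ; right = right′
    ; left-injective = left′-injective ; right-injective = right′-injective
    ; edge = edge′ }
    where
    left′ : Fin (suc k) → Fin (suc m)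
    left′ zero    = zero
    left′ (suc a) = suc (left M a)

    right′ : Fin (suc k) → Fin n
    right′ zero    = w
    right′ (suc a) = right M a

    left′-injective : Injective _≡_ _≡_ left′
    left′-injective {zero}  {zero}  _  = refl
    left′-injective {suc a} {suc b} eq = cong suc (left-injective M (suc-injective eq))

    right′-injective : Injective _≡_ _≡_ right′
    right′-injective {zero}  {zero}  _  = refl
    right′-injective {zero}  {suc b} eq = contradiction (sym eq) (w-unmatched b)
    right′-injective {suc a} {zero}  eq = contradiction eq (w-unmatched a)
    right′-injective {suc a} {suc b} eq = cong suc (right-injective M eq)

    edge′ : ∀ a → right′ a ∈ H (left′ a)
    edge′ zero    = w∈H₀
    edge′ (suc a) = edge M a

  matching-of-≤1-rows : (H : Biadjacency m n) → (∀ i → ∣ H i ∣ ≤ 1) →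
                        ∃[ k ] Matching H k × ∣ Γ H ⊤ ∣ ≤ k
  matching-of-≤1-rows {zero} {n} H _ = 0 , emptyMatching , ≤-reflexive (∣⊥∣≡0 n)
  matching-of-≤1-rows {suc m} H rows≤1
    with matching-of-≤1-rows (tail H) (rows≤1 ∘ suc)
       | any? (λ w → w ∈? head H ×-dec ¬? (w ∈? Γ (tail H) ⊤))
  ... | k , M , ∣R∣≤k | yes (w , w∈H₀ , w∉R) =
    suc k , extendMatching M w∈H₀ w-unmatched ,
    ≤-trans (∣p∪q∣≤∣p∣+∣q∣ (head H) _) (+-mono-≤ (rows≤1 zero) ∣R∣≤k)
    where
    w-unmatched : ∀ a → right M a ≢ w
    w-unmatched a refl = w∉R (∈Γ⁺ (tail H) ⊤ ∈⊤ (edge M a))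
  ... | k , M , ∣R∣≤k | no ∄w = k , Matching-tail M , ≤-trans (p⊆q⇒∣p∣≤∣q∣ H₀∪R⊆R) ∣R∣≤k
    where
    R = Γ (tail H) ⊤
    H₀⊆R : head H ⊆ R
    H₀⊆R {w} w∈H₀ = decidable-stable (w ∈? R) (λ w∉R → ∄w (w , w∈H₀ , w∉R))

    H₀∪R⊆R : head H ∪ R ⊆ R
    H₀∪R⊆R = [ H₀⊆R , id ]′ ∘ x∈p∪q⁻ (head H) R

  delete : Biadjacency m n → Fin m → Fin n → Biadjacency m n
  delete H u w = updateAt H u (_- w)

  delete-⊆ : (H : Biadjacency m n) (u : Fin m) (w : Fin n) → ∀ i → delete H u w i ⊆ H i
  delete-⊆ H u w i with i ≟ u
  ... | yes refl = subst (_⊆ H u) (sym (updateAt-updates u H)) (p─q⊆p (H u) ⁅ w ⁆)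
  ... | no i≢u   = subst (_⊆ H i) (sym (updateAt-minimal i u H i≢u)) id

  delete-⊇-other-rows : (H : Biadjacency m n) {u i : Fin m} (w : Fin n) →
                        i ≢ u → H i ⊆ delete H u w i
  delete-⊇-other-rows H {u} {i} w i≢u = subst (H i ⊆_) (sym (updateAt-minimal i u H i≢u)) id

  delete-cover : (H : Biadjacency m n) (u : Fin m) {w₁ w₂ j : Fin n} → w₁ ≢ w₂ → j ∈ H u →
                 j ∈ delete H u w₁ u ⊎ j ∈ delete H u w₂ u
  delete-cover H u {w₁} {w₂} {j} w₁≢w₂ j∈Hu
    rewrite updateAt-updates u {_- w₁} H | updateAt-updates u {_- w₂} H with j ≟ w₁
  ... | yes refl = inj₂ (x∈p∧x≢y⇒x∈p-y j∈Hu w₁≢w₂)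
  ... | no j≢w₁  = inj₁ (x∈p∧x≢y⇒x∈p-y j∈Hu j≢w₁)

  edgeCount : Biadjacency m n → ℕ
  edgeCount H = sum (λ i → ∣ H i ∣)

  edgeCount-delete : (H : Biadjacency m n) {u : Fin m} {w : Fin n} → w ∈ H u →
                     edgeCount (delete H u w) < edgeCount H
  edgeCount-delete H {zero}  w∈H₀ = +-monoˡ-< _ (x∈p⇒∣p-x∣<∣p∣ w∈H₀)
  edgeCount-delete H {suc u} w∈Hu = +-monoʳ-< ∣ head H ∣ (edgeCount-delete (tail H) w∈Hu)

  HallWithDeficiency : ℕ → Biadjacency m n → Set
  HallWithDeficiency {m} d H = (X : Subset m) → ∣ X ∣ ≤ ∣ Γ H X ∣ + d

  hall-or-violator : ∀ d (H : Biadjacency m n) →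
                     HallWithDeficiency d H ⊎ ∃[ X ] ∣ Γ H X ∣ + d < ∣ X ∣
  hall-or-violator d H with anySubset? (λ X → ∣ Γ H X ∣ + d <? ∣ X ∣)
  ... | yes violator  = inj₂ violator
  ... | no ∄violator = inj₁ (λ X → ≮⇒≥ (∄violator ∘ (X ,_)))

  violator-∋ : {H : Biadjacency m n} {u : Fin m} {w : Fin n} {A : Subset m} →
               HallWithDeficiency d H → ∣ Γ (delete H u w) A ∣ + d < ∣ A ∣ → u ∈ A
  violator-∋ {d = d} {H = H} {u} {w} {A} hall violation with u ∈? A
  ... | yes u∈A = u∈A
  ... | no  u∉A =
    contradiction (hall A) (<⇒≱ (≤-<-trans (+-monoˡ-≤ d (p⊆q⇒∣p∣≤∣q∣ ΓH⊆ΓH′)) violation))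
    where
    ΓH⊆ΓH′ : Γ H A ⊆ Γ (delete H u w) A
    ΓH⊆ΓH′ = Γ-least H A λ i∈A →
      ∈Γ⁺ (delete H u w) A i∈A ∘ delete-⊇-other-rows H w (λ { refl → u∉A i∈A })

  submodular-bound : {H : Biadjacency m n} {u : Fin m} {w₁ w₂ : Fin n} {A₁ A₂ : Subset m} →
    HallWithDeficiency d H → w₁ ≢ w₂ → u ∈ A₁ → u ∈ A₂ →
    ∣ A₁ ∣ + ∣ A₂ ∣ ≤ (∣ Γ (delete H u w₁) A₁ ∣ + d) + suc (∣ Γ (delete H u w₂) A₂ ∣ + d)
  submodular-bound {d = d} {H = H} {u} {w₁} {w₂} {A₁} {A₂} hall w₁≢w₂ u∈A₁ u∈A₂ = begin
    ∣ A₁ ∣ + ∣ A₂ ∣                              ≡⟨ sym (∣p∪q∣+∣p∩q∣≡∣p∣+∣q∣ A₁ A₂) ⟩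
    ∣ A₁ ∪ A₂ ∣ + ∣ A₁ ∩ A₂ ∣                    ≤⟨ +-monoʳ-≤ _ (∣p∣≤1+∣p-x∣ (A₁ ∩ A₂) u) ⟩
    ∣ A₁ ∪ A₂ ∣ + suc ∣ B ∣                      ≤⟨ +-mono-≤ (hall (A₁ ∪ A₂)) (s≤s (hall B)) ⟩
    (∣ Γ H (A₁ ∪ A₂) ∣ + d) + suc (∣ Γ H B ∣ + d) ≤⟨ +-mono-≤ (+-monoˡ-≤ d (p⊆q⇒∣p∣≤∣q∣ Γ∪⊆))
                                                             (s≤s (+-monoˡ-≤ d (p⊆q⇒∣p∣≤∣q∣ Γ∩⊆))) ⟩
    (∣ P₁ ∪ P₂ ∣ + d) + suc (∣ P₁ ∩ P₂ ∣ + d)    ≡⟨ +-suc _ _ ⟩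
    suc ((∣ P₁ ∪ P₂ ∣ + d) + (∣ P₁ ∩ P₂ ∣ + d))  ≡⟨ cong suc (interchange′ (∣ P₁ ∪ P₂ ∣) d (∣ P₁ ∩ P₂ ∣) d) ⟩
    suc ((∣ P₁ ∪ P₂ ∣ + ∣ P₁ ∩ P₂ ∣) + (d + d))  ≡⟨ cong (λ c → suc (c + (d + d))) (∣p∪q∣+∣p∩q∣≡∣p∣+∣q∣ P₁ P₂) ⟩
    suc ((∣ P₁ ∣ + ∣ P₂ ∣) + (d + d))            ≡⟨ cong suc (interchange′ (∣ P₁ ∣) (∣ P₂ ∣) d d) ⟩
    suc ((∣ P₁ ∣ + d) + (∣ P₂ ∣ + d))            ≡⟨ sym (+-suc _ _) ⟩
    (∣ P₁ ∣ + d) + suc (∣ P₂ ∣ + d)              ∎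
    where
    open ≤-Reasoning
    interchange′ = interchange +-commutativeSemigroup
    H₁ = delete H u w₁
    H₂ = delete H u w₂
    P₁ = Γ H₁ A₁
    P₂ = Γ H₂ A₂
    B  = (A₁ ∩ A₂) - u

    Γ∪⊆ : Γ H (A₁ ∪ A₂) ⊆ P₁ ∪ P₂
    Γ∪⊆ = Γ-least H (A₁ ∪ A₂) row⊆
      where
      row⊆ : ∀ {i} → i ∈ A₁ ∪ A₂ → H i ⊆ P₁ ∪ P₂
      row⊆ {i} i∈A₁∪A₂ j∈Hi with i ≟ u
      ... | yes refl =
        x∈p∪q⁺ (Data.Sum.map (∈Γ⁺ H₁ A₁ u∈A₁) (∈Γ⁺ H₂ A₂ u∈A₂) (delete-cover H u w₁≢w₂ j∈Hi))
      ... | no  i≢u  = x∈p∪q⁺ (Data.Sum.map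
        (λ i∈A₁ → ∈Γ⁺ H₁ A₁ i∈A₁ (delete-⊇-other-rows H w₁ i≢u j∈Hi))
        (λ i∈A₂ → ∈Γ⁺ H₂ A₂ i∈A₂ (delete-⊇-other-rows H w₂ i≢u j∈Hi))
        (x∈p∪q⁻ A₁ A₂ i∈A₁∪A₂))

    Γ∩⊆ : Γ H B ⊆ P₁ ∩ P₂
    Γ∩⊆ = Γ-least H B row⊆
      where
      row⊆ : ∀ {i} → i ∈ B → H i ⊆ P₁ ∩ P₂
      row⊆ {i} i∈B j∈Hi =
        let (i∈A₁ , i∈A₂) = x∈p∩q⁻ A₁ A₂ (p─q⊆p (A₁ ∩ A₂) ⁅ u ⁆ i∈B)
            i≢u = x∉⁅y⁆⇒x≢y (x∈p─q⇒x∉q (A₁ ∩ A₂) ⁅ u ⁆ i∈B)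
        in x∈p∩q⁺ ( ∈Γ⁺ H₁ A₁ i∈A₁ (delete-⊇-other-rows H w₁ i≢u j∈Hi)
                  , ∈Γ⁺ H₂ A₂ i∈A₂ (delete-⊇-other-rows H w₂ i≢u j∈Hi))

  deletion-preserves-hall : {H : Biadjacency m n} {u : Fin m} {w₁ w₂ : Fin n} →
    HallWithDeficiency d H → w₁ ≢ w₂ →
    HallWithDeficiency d (delete H u w₁) ⊎ HallWithDeficiency d (delete H u w₂)
  deletion-preserves-hall {d = d} {H = H} {u} {w₁} {w₂} hall w₁≢w₂
    with hall-or-violator d (delete H u w₁) | hall-or-violator d (delete H u w₂)
  ... | inj₁ hall₁       | _                = inj₁ hall₁
  ... | inj₂ _           | inj₁ hall₂       = inj₂ hall₂
  ... | inj₂ (A₁ , v₁)   | inj₂ (A₂ , v₂)   = contradiction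
    (submodular-bound {A₁ = A₁} {A₂} hall w₁≢w₂ (violator-∋ {A = A₁} hall v₁)
                                                (violator-∋ {A = A₂} hall v₂))
    (<⇒≱ (+-mono-≤ v₁ v₂))

  hall-with-deficiency : ∀ d (H : Biadjacency m n) → HallWithDeficiency d H →
                         ∃[ k ] Matching H k × m ≤ k + d
  hall-with-deficiency {m} d H = go H (<-wellFounded (edgeCount H))
    where
    go : (H : Biadjacency m _) → Acc _<_ (edgeCount H) → HallWithDeficiency d H →
         ∃[ k ] Matching H k × m ≤ k + d
    go H (acc smaller) hallH with any? (λ u → 2 ≤? ∣ H u ∣)
    ... | no ∄u = let (k , M , ∣ΓH⊤∣≤k) = matching-of-≤1-rows H rows≤1 in k , M , (begin
      m              ≡⟨ sym (∣⊤∣≡n m) ⟩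
      ∣ ⊤ {m} ∣      ≤⟨ hallH ⊤ ⟩
      ∣ Γ H ⊤ ∣ + d  ≤⟨ +-monoˡ-≤ d ∣ΓH⊤∣≤k ⟩
      k + d          ∎)
      where
      open ≤-Reasoning
      rows≤1 : ∀ i → ∣ H i ∣ ≤ 1
      rows≤1 i = ≤-pred (≰⇒> (∄u ∘ (i ,_)))
    ... | yes (u , 2≤∣Hu∣) =
      let (w₁ , w₂ , w₁∈Hu , w₂∈Hu , w₁≢w₂) = 2≤∣p∣⇒∃≢ 2≤∣Hu∣
      in [ recurse w₁∈Hu , recurse w₂∈Hu ]′ (deletion-preserves-hall hallH w₁≢w₂)
      where
      recurse : ∀ {w} → w ∈ H u → HallWithDeficiency d (delete H u w) →
                ∃[ k ] Matching H k × m ≤ k + d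
      recurse {w} w∈Hu hall′ =
        let (k , M , m≤k+d) = go (delete H u w) (smaller (edgeCount-delete H w∈Hu)) hall′
        in k , Matching-mono (delete-⊆ H u w) M , m≤k+d

  ore-deficiency : (H : Biadjacency m n) → ∃[ k ] Matching H k × ∃[ X ] m + ∣ Γ H X ∣ ≤ k + ∣ X ∣
  ore-deficiency {m} {n} H = descend m (λ X → ≤-trans (∣p∣≤n X) (m≤n+m m _))
    where
    Result : Set
    Result = ∃[ k ] Matching H k × ∃[ X ] m + ∣ Γ H X ∣ ≤ k + ∣ X ∣

    witness : ∀ d → HallWithDeficiency d H → (X : Subset m) → ∣ Γ H X ∣ + d ≤ ∣ X ∣ → Result
    witness d hall-d X ∣ΓX∣+d≤∣X∣ =
      let (k , M , m≤k+d) = hall-with-deficiency d H hall-d in k , M , X , (begin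
      m + ∣ Γ H X ∣        ≤⟨ +-monoˡ-≤ _ m≤k+d ⟩
      k + d + ∣ Γ H X ∣    ≡⟨ +-assoc k d _ ⟩
      k + (d + ∣ Γ H X ∣)  ≡⟨ cong (k +_) (+-comm d _) ⟩
      k + (∣ Γ H X ∣ + d)  ≤⟨ +-monoʳ-≤ k ∣ΓX∣+d≤∣X∣ ⟩
      k + ∣ X ∣            ∎)
      where open ≤-Reasoning

    -- Lower d from the trivial value m until the condition fails for d - 1; the violating set is X.
    descend : ∀ d → HallWithDeficiency d H → Result
    descend zero    hall-0 = witness 0 hall-0 ⊥ (≤-trans (≤-reflexive ∣Γ⊥∣+0≡0) z≤n)
      where
      ∣Γ⊥∣+0≡0 : ∣ Γ H ⊥ ∣ + 0 ≡ 0
      ∣Γ⊥∣+0≡0 = trans (+-identityʳ _) (trans (cong ∣_∣ (Γ-⊥ H)) (∣⊥∣≡0 n))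
    descend (suc d) hall-1+d with hall-or-violator d H
    ... | inj₁ hall-d          = descend d hall-d
    ... | inj₂ (X , violation) =
      witness (suc d) hall-1+d X (subst (_≤ ∣ X ∣) (sym (+-suc _ d)) violation)

module RationalBounds where

  open import Data.Integer as ℤ using (+_)
  import Data.Integer.Properties as ℤ
  open import Data.Nat as ℕ using (ℕ)
  open import Data.Nat.Coprimality as Coprime using (1-coprimeTo)
  open import Data.Rational
  open import Data.Rational.Properties
  open import Data.Rational.Solver using (module +-*-Solver)
  open import Data.Sum using (_⊎_; [_,_]′)
  open import Defs using (ℕ→ℚ)
  open import Function using (_∘_)
  open import Relation.Binary.PropositionalEquality
    using (_≡_; refl; sym; trans; cong; cong₂; subst; subst₂)

  -- The normal form of a / 1, on which _≤_, _<_ and _+_ compute.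
  ℕ→ℚ≡mkℚ : ∀ a → ℕ→ℚ a ≡ mkℚ (+ a) 0 (Coprime.sym (1-coprimeTo a))
  ℕ→ℚ≡mkℚ a = normalize-coprime (Coprime.sym (1-coprimeTo a))

  ℕ→ℚ-nonNeg : ∀ a → 0ℚ ≤ ℕ→ℚ a
  ℕ→ℚ-nonNeg a = nonNegative⁻¹ (ℕ→ℚ a) {{normalize-nonNeg a 1}}

  ℕ→ℚ-mono-≤ : ∀ {a b} → a ℕ.≤ b → ℕ→ℚ a ≤ ℕ→ℚ b
  ℕ→ℚ-mono-≤ {a} {b} a≤b rewrite ℕ→ℚ≡mkℚ a | ℕ→ℚ≡mkℚ b =
    *≤* (ℤ.*-monoʳ-≤-nonNeg (+ 1) (ℤ.+≤+ a≤b))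

  ℕ→ℚ-mono-< : ∀ {a b} → a ℕ.< b → ℕ→ℚ a < ℕ→ℚ b
  ℕ→ℚ-mono-< {a} {b} a<b rewrite ℕ→ℚ≡mkℚ a | ℕ→ℚ≡mkℚ b =
    *<* (ℤ.*-monoʳ-<-pos (+ 1) (ℤ.+<+ a<b))

  ℕ→ℚ-+ : ∀ a b → ℕ→ℚ (a ℕ.+ b) ≡ ℕ→ℚ a + ℕ→ℚ b
  ℕ→ℚ-+ a b rewrite ℕ→ℚ≡mkℚ a | ℕ→ℚ≡mkℚ b =
    cong (_/ 1) (sym (cong₂ ℤ._+_ (ℤ.*-identityʳ (+ a)) (ℤ.*-identityʳ (+ b))))

  p≤q⇒0≤q-p : ∀ {p q} → p ≤ q → 0ℚ ≤ q - p
  p≤q⇒0≤q-p {p} {q} p≤q = subst (_≤ q - p) (+-inverseʳ p) (+-monoˡ-≤ (- p) p≤q)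

  0≤q-p⇒p≤q : ∀ {p q} → 0ℚ ≤ q - p → p ≤ q
  0≤q-p⇒p≤q {p} {q} 0≤q-p = subst₂ _≤_ (+-identityˡ p) q-p+p≡q (+-monoˡ-≤ p 0≤q-p)
    where
    open +-*-Solver
    q-p+p≡q : q - p + p ≡ q
    q-p+p≡q = solve 2 (λ q p → q :- p :+ p := q) refl q p

  +-pres-0≤ : ∀ {p q} → 0ℚ ≤ p → 0ℚ ≤ q → 0ℚ ≤ p + q
  +-pres-0≤ {p} {q} 0≤p 0≤q = subst (_≤ p + q) (+-identityˡ 0ℚ) (+-mono-≤ 0≤p 0≤q)

  *-pres-0≤ : ∀ {p q} → 0ℚ ≤ p → 0ℚ ≤ q → 0ℚ ≤ p * q
  *-pres-0≤ {p} {q} 0≤p 0≤q =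
    nonNegative⁻¹ (p * q) {{nonNeg*nonNeg⇒nonNeg p {{nonNegative 0≤p}} q {{nonNegative 0≤q}}}}

  -- Applied with a = m - |X|, x = |X|, y = |W ∖ Γ(X)|, z = |Γ(X)|, T = t m and s = β².
  weighted-bound : ∀ {a x y z T s} → 0ℚ ≤ a → 0ℚ ≤ z → z < x → a + x ≤ T → T ≤ y + z →
                   x * y ≤ s * (a * z) → T ≤ s * (a + z)
  weighted-bound {a} {x} {y} {z} {T} {s} 0≤a 0≤z z<x a+x≤T T≤y+z xy≤saz =
    *-cancelˡ-≤-pos (a * z) {{positive 0<az}} (0≤q-p⇒p≤q (subst (0ℚ ≤_) slack≡ 0≤slack))
    where
    0≤x   = ≤-trans 0≤z (<⇒≤ z<x)
    a+z≤T = ≤-trans (+-monoʳ-≤ a (<⇒≤ z<x)) a+x≤T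
    0≤T   = ≤-trans (+-pres-0≤ 0≤a 0≤x) a+x≤T
    z<T   = <-≤-trans z<x (≤-trans (subst (_≤ a + x) (+-identityˡ x) (+-monoˡ-≤ x 0≤a)) a+x≤T)

    0<y : 0ℚ < y
    0<y = ≰⇒> λ y≤0 → <-irrefl refl (<-≤-trans z<T (≤-trans T≤y+z
            (subst (y + z ≤_) (+-identityˡ z) (+-monoˡ-≤ z y≤0))))

    0<xy : 0ℚ < x * y
    0<xy = positive⁻¹ (x * y) {{pos*pos⇒pos x {{positive (≤-<-trans 0≤z z<x)}} y {{positive 0<y}}}}

    0<az : 0ℚ < a * z
    0<az = ≰⇒> λ az≤0 → <-irrefl refl (<-≤-trans 0<xy (≤-trans xy≤saz (≤-reflexive
             (trans (cong (s *_) (≤-antisym az≤0 (*-pres-0≤ 0≤a 0≤z))) (*-zeroʳ s)))))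

    -- a z (s (a + z) - T) splits into four nonnegative products; a z > 0 because x y > 0.
    slack = (a + z) * (s * (a * z) - x * y) + (a + z) * x * (y + z - T)
          + T * a * (x - z) + x * z * (T - (a + z))

    0≤slack : 0ℚ ≤ slack
    0≤slack = +-pres-0≤ (+-pres-0≤ (+-pres-0≤
      (*-pres-0≤ (+-pres-0≤ 0≤a 0≤z) (p≤q⇒0≤q-p xy≤saz))
      (*-pres-0≤ (*-pres-0≤ (+-pres-0≤ 0≤a 0≤z) 0≤x) (p≤q⇒0≤q-p T≤y+z)))
      (*-pres-0≤ (*-pres-0≤ 0≤T 0≤a) (p≤q⇒0≤q-p (<⇒≤ z<x))))
      (*-pres-0≤ (*-pres-0≤ 0≤x 0≤z) (p≤q⇒0≤q-p a+z≤T))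

    slack≡ : slack ≡ a * z * (s * (a + z)) - a * z * T
    slack≡ = solve 6 (λ a x y z T s →
        (a :+ z) :* (s :* (a :* z) :- x :* y) :+ (a :+ z) :* x :* (y :+ z :- T)
        :+ T :* a :* (x :- z) :+ x :* z :* (T :- (a :+ z))
      := a :* z :* (s :* (a :+ z)) :- a :* z :* T) refl a x y z T s
      where open +-*-Solver

  1≤t⇒p≤t*p : ∀ {t p} → 1ℚ ≤ t → 0ℚ ≤ p → p ≤ t * p
  1≤t⇒p≤t*p {t} {p} 1≤t 0≤p =
    subst (_≤ t * p) (*-identityˡ p) (*-monoʳ-≤-nonNeg p {{nonNegative 0≤p}} 1≤t)

  ÷-bound : ∀ {t s M K} .{{_ : Positive s}} → t * M ≤ s * K → (t ÷ s) {{pos⇒nonZero s}} * M ≤ K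
  ÷-bound {t} {s} {M} {K} tM≤sK = subst₂ _≤_ tM/s≡ sK/s≡K (*-monoʳ-≤-nonNeg s⁻¹ {{s⁻¹≥0}} tM≤sK)
    where
    instance _ = pos⇒nonZero s
    s⁻¹ = 1/ s
    s⁻¹≥0 = pos⇒nonNeg s⁻¹ {{1/pos⇒pos s}}
    open +-*-Solver
    tM/s≡ : t * M * s⁻¹ ≡ t * s⁻¹ * M
    tM/s≡ = solve 3 (λ t M i → t :* M :* i := t :* i :* M) refl t M s⁻¹
    sK/s≡K : s * K * s⁻¹ ≡ K
    sK/s≡K = trans (solve 3 (λ s K i → s :* K :* i := K :* (s :* i)) refl s K s⁻¹)
                   (trans (cong (K *_) (*-inverseʳ s)) (*-identityʳ K))

  ⊓-bound : ∀ {t s M K} .{{_ : Positive s}} → 0ℚ ≤ M → M ≤ K ⊎ t * M ≤ s * K →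
            ((t ÷ s) {{pos⇒nonZero s}} ⊓ 1ℚ) * M ≤ K
  ⊓-bound {t} {s} {M} 0≤M = [ ≤-trans min*M≤M , ≤-trans min*M≤t/s*M ∘ ÷-bound {t} {s} ]′
    where
    instance _ = nonNegative 0≤M
    t/s = (t ÷ s) {{pos⇒nonZero s}}

    min*M≤M : (t/s ⊓ 1ℚ) * M ≤ M
    min*M≤M = subst ((t/s ⊓ 1ℚ) * M ≤_) (*-identityˡ M) (*-monoʳ-≤-nonNeg M (p⊓q≤q t/s 1ℚ))

    min*M≤t/s*M : (t/s ⊓ 1ℚ) * M ≤ t/s * M
    min*M≤t/s*M = *-monoʳ-≤-nonNeg M (p⊓q≤p t/s 1ℚ)

open import Data.Bool using (true; false)
open import Data.Fin using (Fin)
open import Data.Fin.Subset using (Subset; _∈_; ∣_∣; ∁)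
open import Data.Fin.Subset.Properties using (∣p∣≤n; ∣∁p∣≡n∸∣p∣; x∈∁p⇒x∉p)
open import Data.Product using (_,_)
open import Data.Nat using (_∸_)
import Data.Nat as ℕ
import Data.Nat.Properties as ℕ
import Data.Rational as ℚ
open import Data.Rational.Properties
  using (*-monoˡ-≤-nonNeg; pos*pos⇒pos; pos⇒nonNeg; module ≤-Reasoning)
open import Data.Sum using (_⊎_; inj₁; inj₂)
open import Data.Vec using (tabulate)
open import Data.Vec.Properties using (lookup∘tabulate; []=⇒lookup; lookup⇒[]=)
open import Function using (_∘_)
open import Relation.Binary.PropositionalEquality using (_≡_; refl; sym; trans; cong; subst)
open import Relation.Nullary using (yes; no)
open import Relation.Nullary.Negation using (contradiction)
open Matchings using (Biadjacency; Γ; ∈Γ⁺; ore-deficiency)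
open RationalBounds

open import Defs
open import Data.Nat using (ℕ; _+_)
open import Data.Rational using (ℚ; _≤_; _*_; _÷_; _⊓_; 1ℚ; Positive)

variable
  m n k : ℕ

m+z≤k+x⇒m∸x+z≤k : ∀ {x z} → x ℕ.≤ m → m + z ℕ.≤ k + x → (m ∸ x) + z ℕ.≤ k
m+z≤k+x⇒m∸x+z≤k {m} {k} {x} {z} x≤m m+z≤k+x = begin
  (m ∸ x) + z  ≡⟨ sym (ℕ.+-∸-comm z x≤m) ⟩
  (m + z) ∸ x  ≤⟨ ℕ.∸-monoˡ-≤ x m+z≤k+x ⟩
  (k + x) ∸ x  ≡⟨ ℕ.m+n∸n≡m k x ⟩
  k            ∎
  where open ℕ.≤-Reasoning

rows : BipGraph m n → Biadjacency m n
rows G i = tabulate (G i)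

∈rows⁻ : (G : BipGraph m n) {i : Fin m} {j : Fin n} → j ∈ rows G i → G i j ≡ true
∈rows⁻ G {i} {j} j∈row = trans (sym (lookup∘tabulate (G i) j)) ([]=⇒lookup j∈row)

∈rows⁺ : (G : BipGraph m n) {i : Fin m} {j : Fin n} → G i j ≡ true → j ∈ rows G i
∈rows⁺ G {i} {j} Gij = lookup⇒[]= j _ (trans (lookup∘tabulate (G i) j) Gij)

toBipMatching : (G : BipGraph m n) → Matchings.Matching (rows G) k → Defs.Matching G k
toBipMatching G M = left , right , left-injective , right-injective , ∈rows⁻ G ∘ edge
  where open Matchings.Matching M

noEdges-∁Γ : (G : BipGraph m n) (X : Subset m) → NoEdges G X (∁ (Γ (rows G) X))
noEdges-∁Γ G X i j i∈X j∈∁ΓX with G i j in Gij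
... | false = refl
... | true  = contradiction (∈Γ⁺ (rows G) X i∈X (∈rows⁺ G Gij)) (x∈∁p⇒x∉p j∈∁ΓX)

positive-deficiency-bound : ∀ {t β} (G : BipGraph m n) (X : Subset m) .{{_ : Positive β}} →
  1ℚ ≤ t → IsBetaBipartite G β → t * ℕ→ℚ m ≤ ℕ→ℚ n →
  m + ∣ Γ (rows G) X ∣ ℕ.≤ k + ∣ X ∣ → ∣ Γ (rows G) X ∣ ℕ.< ∣ X ∣ →
  t * ℕ→ℚ m ≤ (β * β) * ℕ→ℚ k
positive-deficiency-bound {m} {n} {k} {t} {β} G X 1≤t βG tm≤n deficiency z<x = begin
  t * ℕ→ℚ m                           ≤⟨ weighted-bound {s = β * β} (ℕ→ℚ-nonNeg (m ∸ x)) (ℕ→ℚ-nonNeg z′)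
                                           (ℕ→ℚ-mono-< z′<x) m≤tm tm≤y+z′ (βG X Y (noEdges-∁Γ G X)) ⟩
  (β * β) * (ℕ→ℚ (m ∸ x) ℚ.+ ℕ→ℚ z′)  ≡⟨ cong ((β * β) *_) (sym (ℕ→ℚ-+ (m ∸ x) z′)) ⟩
  (β * β) * ℕ→ℚ ((m ∸ x) + z′)        ≤⟨ *-monoˡ-≤-nonNeg (β * β) {{β²≥0}} (ℕ→ℚ-mono-≤ m∸x+z′≤k) ⟩
  (β * β) * ℕ→ℚ k                     ∎
  where
  open ≤-Reasoning
  x  = ∣ X ∣
  z  = ∣ Γ (rows G) X ∣
  Y  = ∁ (Γ (rows G) X)
  z′ = n ∸ ∣ Y ∣

  z′≡z : z′ ≡ z
  z′≡z = trans (cong (n ∸_) (∣∁p∣≡n∸∣p∣ (Γ (rows G) X))) (ℕ.m∸[m∸n]≡n (∣p∣≤n (Γ (rows G) X)))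

  z′<x : z′ ℕ.< x
  z′<x = subst (ℕ._< x) (sym z′≡z) z<x

  m≤tm : ℕ→ℚ (m ∸ x) ℚ.+ ℕ→ℚ x ≤ t * ℕ→ℚ m
  m≤tm = subst (_≤ t * ℕ→ℚ m) (trans (cong ℕ→ℚ (sym (ℕ.m∸n+n≡m (∣p∣≤n X)))) (ℕ→ℚ-+ (m ∸ x) x))
    (1≤t⇒p≤t*p 1≤t (ℕ→ℚ-nonNeg m))

  tm≤y+z′ : t * ℕ→ℚ m ≤ ℕ→ℚ ∣ Y ∣ ℚ.+ ℕ→ℚ z′
  tm≤y+z′ = subst (t * ℕ→ℚ m ≤_) (trans (cong ℕ→ℚ (sym (ℕ.m+[n∸m]≡n (∣p∣≤n Y)))) (ℕ→ℚ-+ ∣ Y ∣ z′)) tm≤n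

  β²≥0 = pos⇒nonNeg (β * β) {{pos*pos⇒pos β β}}

  m∸x+z′≤k : (m ∸ x) + z′ ℕ.≤ k
  m∸x+z′≤k = subst (λ c → (m ∸ x) + c ℕ.≤ k) (sym z′≡z) (m+z≤k+x⇒m∸x+z≤k (∣p∣≤n X) deficiency)

deficient-set-bound : ∀ {t β} (G : BipGraph m n) (X : Subset m) .{{_ : Positive β}} →
  1ℚ ≤ t → IsBetaBipartite G β → t * ℕ→ℚ m ≤ ℕ→ℚ n →
  m + ∣ Γ (rows G) X ∣ ℕ.≤ k + ∣ X ∣ → ℕ→ℚ m ≤ ℕ→ℚ k ⊎ t * ℕ→ℚ m ≤ (β * β) * ℕ→ℚ k
deficient-set-bound {m} {n} {k} {t} {β} G X 1≤t βG tm≤n deficiency with ∣ X ∣ ℕ.≤? ∣ Γ (rows G) X ∣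
... | yes x≤z = inj₁ (ℕ→ℚ-mono-≤ (ℕ.+-cancelʳ-≤ _ m k (ℕ.≤-trans deficiency (ℕ.+-monoʳ-≤ k x≤z))))
... | no  x≰z = inj₂ (positive-deficiency-bound {β = β} G X 1≤t βG tm≤n deficiency (ℕ.≰⇒> x≰z))

theorem5p1 : (t β : ℚ) → 1ℚ ≤ t → .{{_ : Positive β}} →
    (m n : ℕ) → 1 Data.Nat.≤ m + n → (G : BipGraph m n) →
    Connected G → IsBetaBipartite G β → t * ℕ→ℚ m ≤ ℕ→ℚ n →
    MatchingNumberAtLeast G (((t ÷ (β * β)) {{sq-nonZero β}} ⊓ 1ℚ) * ℕ→ℚ m)
theorem5p1 t β 1≤t m n _ G _ βG tm≤n =
  let (k , M , X , deficiency) = ore-deficiency (rows G)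
  in k , toBipMatching G M ,
     ⊓-bound {t} {β * β} {{pos*pos⇒pos β β}} (ℕ→ℚ-nonNeg m)
       (deficient-set-bound {t = t} {β} G X 1≤t βG tm≤n deficiency)
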